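{- Let $d\ge 0$ and $k\ge 1$ be integers, and let $G=(B\uplus W,E)$ be a $d$-degenerated black and white graph. If $|B|>(4d+2)k$, then there are at most $(4d+2)k$ vertices $v$ of $G$ that dominate at least $|B|/k$ vertices of $B$, i.e. $|\{v\in B\cup W : |(N(v)\cup\{v\})\cap B|\ge |B|/k\}|\le (4d+2)k$.
   Context: All graphs are finite, undirected and simple. A graph $G$ is $d$-degenerated if every induced subgraph of $G$ has a vertex of degree at most $d$. A black and white graph $G=(B\uplus W,E)$ is a graph whose vertex set is partitioned into two disjoint sets $B$ (black vertices) and $W$ (white vertices). For a vertex $v$, $N(v)$ is the set of vertices adjacent to $v$ (not including $v$), and $v$ is said to dominate the vertices of $N(v)\cup\{v\}$. -}

module Defs where

open import Data.Nat using (ℕ; _≤_; _*_; _≤ᵇ_)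
open import Data.Bool using (Bool; true; false; T)
open import Data.Fin using (Fin)
open import Data.Fin.Subset using (Subset; Nonempty; _∈_; _∩_; _∪_; ⁅_⁆; ∣_∣)
open import Data.Vec using (tabulate)
open import Data.Product using (∃; _×_)
open import Relation.Binary.PropositionalEquality using (_≡_)

record Graph (n : ℕ) : Set where
  field
    adj   : Fin n → Fin n → Bool
    sym   : ∀ u v → adj u v ≡ adj v u
    irrfl : ∀ v → adj v v ≡ false

open Graph public

N : ∀ {n} → Graph n → Fin n → Subset n
N G v = tabulate (λ u → adj G v u)

N[_] : ∀ {n} → Graph n → Fin n → Subset n
N[ G ] v = N G v ∪ ⁅ v ⁆

degIn : ∀ {n} → Graph n → Subset n → Fin n → ℕ
degIn G S v = ∣ N G v ∩ S ∣

Degenerated : ℕ → ∀ {n} → Graph n → Set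
Degenerated d G = ∀ S → Nonempty S → ∃ λ v → v ∈ S × degIn G S v ≤ d

-- A black and white graph: a graph together with the set B of black
-- vertices; the white vertices W are the complement of B.
record BWGraph (n : ℕ) : Set where
  field
    graph : Graph n
    B     : Subset n

-- v dominates at least |B|/k black vertices:  |N[v] ∩ B| ≥ |B|/k,
-- stated without division as  |B| ≤ k * |N[v] ∩ B|.
DominatesMany : ∀ {n} → (k : ℕ) → BWGraph n → Fin n → Bool
DominatesMany k H v = ∣ BWGraph.B H ∣ ≤ᵇ (k * ∣ N[ BWGraph.graph H ] v ∩ BWGraph.B H ∣)

heavy : ∀ {n} → ℕ → BWGraph n → Subset n
heavy k H = tabulate (DominatesMany k H)

-- A heavy vertex v satisfies |B| ≤ k (deg_B v + 1), so summing over the heavy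
-- set H gives |H| |B| ≤ k (e(H, B) + |H|), where e(H, B) counts the pairs
-- (v, u) ∈ H × B with uv an edge. These pairs are incidences of the subgraph
-- induced by H ∪ B, and a d-degenerated graph on t vertices has at most 2 d t
-- incidences (remove a vertex of degree ≤ d and induct). Hence
-- |H| |B| ≤ a (|H| + |B|) with a = (2d + 1) k, i.e. (|H| − a)(|B| − a) ≤ a²,
-- which fails if both |H| and |B| exceed 2a.
module Submission where

open import Defs
open import Data.Nat using (ℕ; _≤_; _<_; _*_; _+_)
open import Data.Fin.Subset using (∣_∣)

open import Data.Nat.Properties
open import Algebra.Properties.Semiring.Sum +-*-semiring
  using (sum; sum-syntax; sum-cong-≗; ∑-distrib-+; ∑-comm; *-distribˡ-sum; *-distribʳ-sum)
open import Data.Bool.Base using (Bool; true; false; _∧_; T)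
open import Data.Fin.Base using (Fin; zero; suc)
open import Data.Fin.Subset
  using (Subset; inside; _∈_; _⊆_; _∩_; _∪_; _─_; _-_; ⁅_⁆; ⊥)
open import Data.Fin.Subset.Properties
  using (nonempty?; Empty-unique; p⊆p∪q; q⊆p∪q; p─⊥≡p; p─q⊆p; x∈p⇒∣p-x∣<∣p∣; ∣p∩q∣≤∣p∣; ∣⁅x⁆∣≡1; ∩-distribʳ-∪)
open import Data.Nat.Base using (zero; suc; z≤n; s≤s)
open import Data.Nat.Induction using (<-wellFounded)
open import Data.Nat.Tactic.RingSolver using (solve-∀)
open import Data.Product.Base using (_,_)
open import Data.Unit.Base using (tt)
open import Data.Vec.Base using ([]; _∷_; lookup; there)
open import Data.Vec.Functional using (Vector)
open import Data.Vec.Properties using (lookup-replicate; lookup-zipWith; lookup∘tabulate; lookup⇒[]=; []=⇒lookup)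
open import Function.Base using (_∘_)
open import Induction.WellFounded using (Acc; acc)
open import Relation.Binary.PropositionalEquality as ≡
  using (_≡_; _≗_; refl; cong; cong₂; subst; module ≡-Reasoning)
open import Relation.Nullary using (yes; no; contradiction)

⟦_⟧ : Bool → ℕ
⟦ true ⟧  = 1
⟦ false ⟧ = 0

⟦∧⟧ : ∀ x y → ⟦ x ∧ y ⟧ ≡ ⟦ x ⟧ * ⟦ y ⟧
⟦∧⟧ true  y = ≡.sym (+-identityʳ ⟦ y ⟧)
⟦∧⟧ false y = refl

χ : ∀ {n} → Subset n → Vector ℕ n
χ S i = ⟦ lookup S i ⟧

∣p∣≡∑χp : ∀ {n} (p : Subset n) → ∣ p ∣ ≡ sum (χ p)
∣p∣≡∑χp []          = refl
∣p∣≡∑χp (true ∷ p)  = cong suc (∣p∣≡∑χp p)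
∣p∣≡∑χp (false ∷ p) = ∣p∣≡∑χp p

χ-∩ : ∀ {n} (p q : Subset n) i → χ (p ∩ q) i ≡ χ p i * χ q i
χ-∩ p q i = ≡.trans (cong ⟦_⟧ (lookup-zipWith _∧_ i p q)) (⟦∧⟧ (lookup p i) (lookup q i))

χ-mono : ∀ {n} {p q : Subset n} → p ⊆ q → ∀ i → χ p i ≤ χ q i
χ-mono {p = p} p⊆q i with lookup p i in eq
... | false = z≤n
... | true rewrite []=⇒lookup (p⊆q (lookup⇒[]= i p eq)) = ≤-refl

χ*-mono : ∀ {n} (S : Subset n) i {a b} → (lookup S i ≡ true → a ≤ b) → χ S i * a ≤ χ S i * b
χ*-mono S i a≤b with lookup S i
... | false = z≤n
... | true  = *-monoʳ-≤ 1 (a≤b refl)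

χ-remove : ∀ {n} {v : Fin n} {S : Subset n} → v ∈ S → ∀ i → χ S i ≡ χ (S - v) i + χ ⁅ v ⁆ i
χ-remove {v = zero}  {inside ∷ S} _ zero = refl
χ-remove {v = zero}  {inside ∷ S} _ (suc i) = χ-─⊥
  where
  -- The goal mentions _─_ unfolded (with its local helper), so p─⊥≡p cannot
  -- be used to rewrite it; restating it recovers the folded form.
  χ-─⊥ : χ S i ≡ χ (S ─ ⊥) i + χ ⊥ i
  χ-─⊥ rewrite p─⊥≡p S | lookup-replicate i false = ≡.sym (+-identityʳ (χ S i))
χ-remove {v = suc v} {x ∷ S} _ zero = ≡.sym (+-identityʳ ⟦ x ⟧)
χ-remove {v = suc v} {x ∷ S} (there v∈S) (suc i) = χ-remove v∈S i

∣p∪q∣≤∣p∣+∣q∣ : ∀ {n} (p q : Subset n) → ∣ p ∪ q ∣ ≤ ∣ p ∣ + ∣ q ∣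
∣p∪q∣≤∣p∣+∣q∣ []          []          = z≤n
∣p∪q∣≤∣p∣+∣q∣ (true ∷ p)  (true ∷ q)  = s≤s (≤-trans (∣p∪q∣≤∣p∣+∣q∣ p q) (+-monoʳ-≤ ∣ p ∣ (n≤1+n ∣ q ∣)))
∣p∪q∣≤∣p∣+∣q∣ (true ∷ p)  (false ∷ q) = s≤s (∣p∪q∣≤∣p∣+∣q∣ p q)
∣p∪q∣≤∣p∣+∣q∣ (false ∷ p) (true ∷ q)  = subst (suc ∣ p ∪ q ∣ ≤_) (≡.sym (+-suc ∣ p ∣ ∣ q ∣)) (s≤s (∣p∪q∣≤∣p∣+∣q∣ p q))
∣p∪q∣≤∣p∣+∣q∣ (false ∷ p) (false ∷ q) = ∣p∪q∣≤∣p∣+∣q∣ p q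

sum-mono-≤ : ∀ {n} {f g : Vector ℕ n} → (∀ i → f i ≤ g i) → sum f ≤ sum g
sum-mono-≤ {zero}  f≤g = z≤n
sum-mono-≤ {suc n} f≤g = +-mono-≤ (f≤g zero) (sum-mono-≤ (f≤g ∘ suc))

∑χ⊥* : ∀ {n} (f : Vector ℕ n) → ∑[ i < n ] (χ ⊥ i * f i) ≡ 0
∑χ⊥* {zero}  f = refl
∑χ⊥* {suc n} f = ∑χ⊥* (f ∘ suc)

∑χ⁅v⁆* : ∀ {n} (v : Fin n) (f : Vector ℕ n) → ∑[ i < n ] (χ ⁅ v ⁆ i * f i) ≡ f v
∑χ⁅v⁆* zero    f = ≡.trans (cong₂ _+_ (+-identityʳ (f zero)) (∑χ⊥* (f ∘ suc))) (+-identityʳ (f zero))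
∑χ⁅v⁆* (suc v) f = ∑χ⁅v⁆* v (f ∘ suc)

∑*χ⁅v⁆ : ∀ {n} (v : Fin n) (f : Vector ℕ n) → ∑[ i < n ] (f i * χ ⁅ v ⁆ i) ≡ f v
∑*χ⁅v⁆ v f = ≡.trans (sum-cong-≗ (λ i → *-comm (f i) (χ ⁅ v ⁆ i))) (∑χ⁅v⁆* v f)

SymmetricMatrix : ∀ {n} → (Fin n → Fin n → ℕ) → Set
SymmetricMatrix M = ∀ i j → M i j ≡ M j i

module _ {n : ℕ} (M : Fin n → Fin n → ℕ) where

  mulVec : Vector ℕ n → Vector ℕ n
  mulVec y i = ∑[ j < n ] (M i j * y j)

  form : Vector ℕ n → Vector ℕ n → ℕ
  form x y = ∑[ i < n ] (x i * mulVec y i)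

  form-cong : ∀ {x x′ y y′} → x ≗ x′ → y ≗ y′ → form x y ≡ form x′ y′
  form-cong x≗x′ y≗y′ =
    sum-cong-≗ (λ i → cong₂ _*_ (x≗x′ i) (sum-cong-≗ (λ j → cong (M i j *_) (y≗y′ j))))

  form-mono-≤ : ∀ {x x′ y y′} → (∀ i → x i ≤ x′ i) → (∀ j → y j ≤ y′ j) → form x y ≤ form x′ y′
  form-mono-≤ x≤x′ y≤y′ =
    sum-mono-≤ (λ i → *-mono-≤ (x≤x′ i) (sum-mono-≤ (λ j → *-monoʳ-≤ (M i j) (y≤y′ j))))

  form-distribˡ : ∀ x x′ y → form (λ i → x i + x′ i) y ≡ form x y + form x′ y
  form-distribˡ x x′ y = ≡.trans
    (sum-cong-≗ (λ i → *-distribʳ-+ (mulVec y i) (x i) (x′ i)))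
    (∑-distrib-+ (λ i → x i * mulVec y i) (λ i → x′ i * mulVec y i))

  form-distribʳ : ∀ x y y′ → form x (λ j → y j + y′ j) ≡ form x y + form x y′
  form-distribʳ x y y′ = ≡.trans
    (sum-cong-≗ (λ i → ≡.trans
      (cong (x i *_) (≡.trans (sum-cong-≗ (λ j → *-distribˡ-+ (M i j) (y j) (y′ j)))
                              (∑-distrib-+ (λ j → M i j * y j) (λ j → M i j * y′ j))))
      (*-distribˡ-+ (x i) (mulVec y i) (mulVec y′ i))))
    (∑-distrib-+ (λ i → x i * mulVec y i) (λ i → x i * mulVec y′ i))

  form-χ⁅v⁆ˡ : ∀ v y → form (χ ⁅ v ⁆) y ≡ mulVec y v
  form-χ⁅v⁆ˡ v y = ∑χ⁅v⁆* v (mulVec y)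

  form-comm : SymmetricMatrix M → ∀ x y → form x y ≡ form y x
  form-comm M-sym x y = begin
    ∑[ i < n ] (x i * mulVec y i)                  ≡⟨ sum-cong-≗ (λ i → *-distribˡ-sum (x i) (λ j → M i j * y j)) ⟩
    ∑[ i < n ] ∑[ j < n ] (x i * (M i j * y j))    ≡⟨ ∑-comm (λ i j → x i * (M i j * y j)) ⟩
    ∑[ j < n ] ∑[ i < n ] (x i * (M i j * y j))    ≡⟨ sum-cong-≗ (λ j → sum-cong-≗ (λ i → transpose i j)) ⟩
    ∑[ j < n ] ∑[ i < n ] (y j * (M j i * x i))    ≡⟨ sum-cong-≗ (λ j → *-distribˡ-sum (y j) (λ i → M j i * x i)) ⟨
    ∑[ j < n ] (y j * mulVec x j)                  ∎
    where
    open ≡-Reasoning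
    swap : ∀ a b c → a * (c * b) ≡ b * (c * a)
    swap = solve-∀
    transpose : ∀ i j → x i * (M i j * y j) ≡ y j * (M j i * x i)
    transpose i j = ≡.trans (swap (x i) (y j) (M i j)) (cong (λ c → y j * (c * x i)) (M-sym i j))

  form-expand : SymmetricMatrix M → ∀ x e →
    form (λ i → x i + e i) (λ i → x i + e i) ≡ 2 * form e x + form x x + form e e
  form-expand M-sym x e = begin
    form (λ i → x i + e i) (λ i → x i + e i)
      ≡⟨ form-distribˡ x e _ ⟩
    form x (λ i → x i + e i) + form e (λ i → x i + e i)
      ≡⟨ cong₂ _+_ (form-distribʳ x x e) (form-distribʳ e x e) ⟩
    (form x x + form x e) + (form e x + form e e)
      ≡⟨ cong (λ t → (form x x + t) + (form e x + form e e)) (form-comm M-sym x e) ⟩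
    (form x x + form e x) + (form e x + form e e)
      ≡⟨ rearrange (form x x) (form e x) (form e e) ⟩
    2 * form e x + form x x + form e e
      ∎
    where
    open ≡-Reasoning
    rearrange : ∀ a b c → (a + b) + (b + c) ≡ 2 * b + a + c
    rearrange = solve-∀

module _ {n : ℕ} (G : Graph n) where

  adjacency : Fin n → Fin n → ℕ
  adjacency u v = ⟦ adj G u v ⟧

  adjacency-sym : SymmetricMatrix adjacency
  adjacency-sym u v = cong ⟦_⟧ (sym G u v)

  -- Twice the number of edges of the subgraph induced by S.
  incidences : Subset n → ℕ
  incidences S = form adjacency (χ S) (χ S)

  degIn≡mulVec : ∀ S v → degIn G S v ≡ mulVec adjacency (χ S) v
  degIn≡mulVec S v = ≡.trans (∣p∣≡∑χp (N G v ∩ S)) (sum-cong-≗ λ u → ≡.trans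
    (χ-∩ (N G v) S u)
    (cong (λ b → ⟦ b ⟧ * χ S u) (lookup∘tabulate (adj G v) u)))

  degIn-mono : ∀ {S T} → S ⊆ T → ∀ v → degIn G S v ≤ degIn G T v
  degIn-mono {S} {T} S⊆T v = begin
    degIn G S v                ≡⟨ degIn≡mulVec S v ⟩
    mulVec adjacency (χ S) v   ≤⟨ sum-mono-≤ (λ u → *-monoʳ-≤ (adjacency v u) (χ-mono S⊆T u)) ⟩
    mulVec adjacency (χ T) v   ≡⟨ degIn≡mulVec T v ⟨
    degIn G T v                ∎
    where open ≤-Reasoning

  incidences-⊥ : incidences ⊥ ≡ 0
  incidences-⊥ = ∑χ⊥* (mulVec adjacency (χ ⊥))

  incidences-remove : ∀ {S v} → v ∈ S → incidences S ≡ 2 * degIn G (S - v) v + incidences (S - v)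
  incidences-remove {S} {v} v∈S = begin
    incidences S
      ≡⟨ form-cong adjacency (χ-remove v∈S) (χ-remove v∈S) ⟩
    form adjacency (λ i → χ (S - v) i + e i) (λ i → χ (S - v) i + e i)
      ≡⟨ form-expand adjacency adjacency-sym (χ (S - v)) e ⟩
    2 * form adjacency e (χ (S - v)) + incidences (S - v) + form adjacency e e
      ≡⟨ cong₂ (λ a b → 2 * a + incidences (S - v) + b) deg-v no-loop ⟩
    2 * degIn G (S - v) v + incidences (S - v) + 0
      ≡⟨ +-identityʳ _ ⟩
    2 * degIn G (S - v) v + incidences (S - v)
      ∎
    where
    open ≡-Reasoning
    e : Vector ℕ n
    e = χ ⁅ v ⁆
    deg-v : form adjacency e (χ (S - v)) ≡ degIn G (S - v) v
    deg-v = ≡.trans (form-χ⁅v⁆ˡ adjacency v _) (≡.sym (degIn≡mulVec (S - v) v))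
    no-loop : form adjacency e e ≡ 0
    no-loop = ≡.trans (form-χ⁅v⁆ˡ adjacency v e)
      (≡.trans (∑*χ⁅v⁆ v (adjacency v)) (cong ⟦_⟧ (irrfl G v)))

  degenerated⇒incidences≤2d∣S∣ : ∀ {d} → Degenerated d G → ∀ S → incidences S ≤ 2 * d * ∣ S ∣
  degenerated⇒incidences≤2d∣S∣ {d} D S = go S (<-wellFounded ∣ S ∣)
    where
    go : ∀ S → Acc _<_ ∣ S ∣ → incidences S ≤ 2 * d * ∣ S ∣
    go S _ with nonempty? S
    go S _ | no S-empty = subst (_≤ 2 * d * ∣ S ∣)
      (≡.sym (≡.trans (cong incidences (Empty-unique S-empty)) incidences-⊥)) z≤n
    go S (acc smaller) | yes S-nonempty with D S S-nonempty
    ... | v , v∈S , deg≤d = begin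
      incidences S                                ≡⟨ incidences-remove v∈S ⟩
      2 * degIn G (S - v) v + incidences (S - v)  ≤⟨ +-mono-≤ (*-monoʳ-≤ 2 deg′≤d) (go (S - v) (smaller ∣S-v∣<∣S∣)) ⟩
      2 * d + 2 * d * ∣ S - v ∣                   ≡⟨ *-suc (2 * d) ∣ S - v ∣ ⟨
      2 * d * suc ∣ S - v ∣                       ≤⟨ *-monoʳ-≤ (2 * d) ∣S-v∣<∣S∣ ⟩
      2 * d * ∣ S ∣                               ∎
      where
      open ≤-Reasoning
      ∣S-v∣<∣S∣ : ∣ S - v ∣ < ∣ S ∣
      ∣S-v∣<∣S∣ = x∈p⇒∣p-x∣<∣p∣ v∈S
      deg′≤d : degIn G (S - v) v ≤ d
      deg′≤d = ≤-trans (degIn-mono (p─q⊆p S ⁅ v ⁆) v) deg≤d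

  ∣N[v]∩S∣≤degIn+1 : ∀ S v → ∣ N[ G ] v ∩ S ∣ ≤ degIn G S v + 1
  ∣N[v]∩S∣≤degIn+1 S v = begin
    ∣ (N G v ∪ ⁅ v ⁆) ∩ S ∣          ≡⟨ cong ∣_∣ (∩-distribʳ-∪ S (N G v) ⁅ v ⁆) ⟩
    ∣ N G v ∩ S ∪ ⁅ v ⁆ ∩ S ∣        ≤⟨ ∣p∪q∣≤∣p∣+∣q∣ (N G v ∩ S) (⁅ v ⁆ ∩ S) ⟩
    degIn G S v + ∣ ⁅ v ⁆ ∩ S ∣      ≤⟨ +-monoʳ-≤ (degIn G S v) (∣p∩q∣≤∣p∣ ⁅ v ⁆ S) ⟩
    degIn G S v + ∣ ⁅ v ⁆ ∣          ≡⟨ cong (degIn G S v +_) (∣⁅x⁆∣≡1 v) ⟩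
    degIn G S v + 1                  ∎
    where open ≤-Reasoning

module _ {n : ℕ} (k : ℕ) (H : BWGraph n) where
  open BWGraph H

  heavy⇒∣B∣≤k*[degIn+1] : ∀ v → lookup (heavy k H) v ≡ true → ∣ B ∣ ≤ k * (degIn graph B v + 1)
  heavy⇒∣B∣≤k*[degIn+1] v v-heavy = ≤-trans
    (≤ᵇ⇒≤ ∣ B ∣ _ (subst T (≡.sym (≡.trans (≡.sym (lookup∘tabulate (DominatesMany k H) v)) v-heavy)) tt))
    (*-monoʳ-≤ k (∣N[v]∩S∣≤degIn+1 graph B v))

  ∣heavy∣*∣B∣≤k*[form+∣heavy∣] : ∣ heavy k H ∣ * ∣ B ∣ ≤ k * (form (adjacency graph) (χ (heavy k H)) (χ B) + ∣ heavy k H ∣)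
  ∣heavy∣*∣B∣≤k*[form+∣heavy∣] = begin
    ∣ heavy k H ∣ * ∣ B ∣                    ≡⟨ cong (_* ∣ B ∣) (∣p∣≡∑χp (heavy k H)) ⟩
    sum x * ∣ B ∣                            ≡⟨ *-distribʳ-sum ∣ B ∣ x ⟩
    ∑[ v < n ] (x v * ∣ B ∣)                 ≤⟨ sum-mono-≤ (λ v → χ*-mono (heavy k H) v (bound v)) ⟩
    ∑[ v < n ] (x v * (k * (s v + 1)))       ≡⟨ sum-cong-≗ (λ v → regroup (x v) k (s v)) ⟩
    ∑[ v < n ] (k * (x v * s v + x v))       ≡⟨ *-distribˡ-sum k (λ v → x v * s v + x v) ⟨
    k * ∑[ v < n ] (x v * s v + x v)         ≡⟨ cong (k *_) (∑-distrib-+ (λ v → x v * s v) x) ⟩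
    k * (form (adjacency graph) x (χ B) + sum x)
      ≡⟨ cong (λ t → k * (form (adjacency graph) x (χ B) + t)) (∣p∣≡∑χp (heavy k H)) ⟨
    k * (form (adjacency graph) x (χ B) + ∣ heavy k H ∣)  ∎
    where
    open ≤-Reasoning
    x s : Vector ℕ n
    x = χ (heavy k H)
    s = mulVec (adjacency graph) (χ B)
    bound : ∀ v → lookup (heavy k H) v ≡ true → ∣ B ∣ ≤ k * (s v + 1)
    bound v v-heavy = subst (λ t → ∣ B ∣ ≤ k * (t + 1)) (degIn≡mulVec graph B v) (heavy⇒∣B∣≤k*[degIn+1] v v-heavy)
    regroup : ∀ x k s → x * (k * (s + 1)) ≡ k * (x * s + x)
    regroup = solve-∀

product-exceeds : ∀ a r s → a * (suc (a + a + r) + suc (a + a + s)) < suc (a + a + r) * suc (a + a + s)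
product-exceeds a r s = +-cancelʳ-< (a * a) _ _ (begin-strict
  a * (m + n) + a * a                    <⟨ +-monoʳ-< (a * (m + n)) (*-mono-< (s≤s (m≤m+n a r)) (s≤s (m≤m+n a s))) ⟩
  a * (m + n) + suc (a + r) * suc (a + s) ≡⟨ expand a r s ⟩
  m * n + a * a                          ∎)
  where
  open ≤-Reasoning
  m n : ℕ
  m = suc (a + a + r)
  n = suc (a + a + s)
  expand : ∀ a r s → a * (suc (a + a + r) + suc (a + a + s)) + suc (a + r) * suc (a + s)
                   ≡ suc (a + a + r) * suc (a + a + s) + a * a
  expand = solve-∀

product-bound : ∀ a m n → m * n ≤ a * (m + n) → a + a < n → m ≤ a + a
product-bound a m n mn≤ 2a<n with m ≤? a + a
... | yes m≤2a = m≤2a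
... | no m≰2a with m≤n⇒∃[o]m+o≡n (≰⇒> m≰2a) | m≤n⇒∃[o]m+o≡n 2a<n
...   | r , refl | s , refl = contradiction mn≤ (<⇒≱ (product-exceeds a r s))

lemma1 : (d k : ℕ) → 1 ≤ k → {n : ℕ} → (H : BWGraph n)
    → Degenerated d (BWGraph.graph H)
    → (4 * d + 2) * k < ∣ BWGraph.B H ∣
    → ∣ heavy k H ∣ ≤ (4 * d + 2) * k
lemma1 d k _ H D c<∣B∣ =
  subst (h ≤_) (≡.sym c≡a+a) (product-bound a h β counting (subst (_< β) c≡a+a c<∣B∣))
  where
  open BWGraph H
  h β a : ℕ
  h = ∣ heavy k H ∣
  β = ∣ B ∣
  a = k * (2 * d + 1)
  c≡a+a : (4 * d + 2) * k ≡ a + a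
  c≡a+a = halve d k
    where
    halve : ∀ d k → (4 * d + 2) * k ≡ k * (2 * d + 1) + k * (2 * d + 1)
    halve = solve-∀
  counting : h * β ≤ a * (h + β)
  counting = begin
    h * β                                        ≤⟨ ∣heavy∣*∣B∣≤k*[form+∣heavy∣] k H ⟩
    k * (form (adjacency graph) (χ (heavy k H)) (χ B) + h)
      ≤⟨ *-monoʳ-≤ k (+-monoˡ-≤ h (form-mono-≤ (adjacency graph) (χ-mono (p⊆p∪q {p = heavy k H} B)) (χ-mono (q⊆p∪q (heavy k H) B)))) ⟩
    k * (incidences graph (heavy k H ∪ B) + h)
      ≤⟨ *-monoʳ-≤ k (+-mono-≤ (≤-trans (degenerated⇒incidences≤2d∣S∣ graph D (heavy k H ∪ B))
                                          (*-monoʳ-≤ (2 * d) (∣p∪q∣≤∣p∣+∣q∣ (heavy k H) B)))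
                               (m≤m+n h β)) ⟩
    k * (2 * d * (h + β) + (h + β))              ≡⟨ regroup k d (h + β) ⟩
    a * (h + β)                                  ∎
    where
    open ≤-Reasoning
    regroup : ∀ k d t → k * (2 * d * t + t) ≡ k * (2 * d + 1) * t
    regroup = solve-∀
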